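{- Let $f_0,\dots,f_m\colon\{ -1,1\}^n\to\mathbb R$ and $g_0,\dots,g_n\colon\{ -1,1\}^m\to\mathbb R$ satisfy $f_0(g_1(z_{1\cdot}),\dots,g_n(z_{n\cdot}))=g_0(f_1(z_{\cdot1}),\dots,f_m(z_{\cdot m}))$ for all $z\in\{ -1,1\}^{[n]\times[m]}$, where $f_1,\dots,f_m,g_1,\dots,g_n$ are balanced and non-constant. Let $S$ be inclusion-maximal in $\mathrm{supp}(\hat f_0)$, and for each $i\in S$ let $U_i$ be inclusion-maximal in $\mathrm{supp}(\hat g_i)$. Let $T=\bigcup_{i\in S}U_i$ and, for $j\in T$, $V_j=\{i\in S:j\in U_i\}$. Then $T$ is inclusion-maximal in $\mathrm{supp}(\hat g_0)$, and each $V_j$ ($j\in T$) is inclusion-maximal in $\mathrm{supp}(\hat f_j)$.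
   Context: Here $z_{i\cdot}=(z_{i1},\dots,z_{im})$ and $z_{\cdot j}=(z_{1j},\dots,z_{nj})$. Functions are identified with their multilinear expansions $f=\sum_S\hat f(S)\prod_{i\in S}x_i$; $\mathrm{supp}(\hat f)=\{S:\hat f(S)\ne0\}$; balanced means $\hat f(\emptyset)=0$. -}

module Defs where

open import Level using (0ℓ)
open import Algebra.Bundles using (CommutativeRing)
open import Data.Bool using (Bool; true; false; if_then_else_)
open import Data.Nat using (ℕ; zero; suc)
open import Data.Fin using (Fin; zero; suc)
open import Data.Vec using (Vec; []; _∷_; lookup; tabulate)
open import Data.Fin.Subset using (Subset; _∈_; _⊆_; _∪_; _∩_; ⊥; inside; outside)
open import Data.Product using (Σ; _×_; ∃; _,_)
open import Data.Sum using (_⊎_)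
open import Relation.Nullary using (¬_)
open import Relation.Binary.PropositionalEquality using (_≡_)

-- The real numbers, axiomatised as a Dedekind-complete ordered field.
-- (Any model is isomorphic to ℝ, so quantifying over all models is
-- the same as speaking about ℝ.)

record RealField : Set₁ where
  field
    commRing : CommutativeRing 0ℓ 0ℓ
  open CommutativeRing commRing public
  field
    _<_       : Carrier → Carrier → Set
    <-resp-≈  : ∀ {x x′ y y′} → x ≈ x′ → y ≈ y′ → x < y → x′ < y′
    <-irrefl  : ∀ {x} → ¬ (x < x)
    <-trans   : ∀ {x y z} → x < y → y < z → x < z
    <-tri     : ∀ x y → x < y ⊎ (x ≈ y ⊎ y < x)
    +-mono-<  : ∀ {x y} z → x < y → (x + z) < (y + z)
    *-pos     : ∀ {x y} → 0# < x → 0# < y → 0# < (x * y)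
    0<1       : 0# < 1#
    inverse   : ∀ x → ¬ (x ≈ 0#) → Σ Carrier (λ y → (x * y) ≈ 1#)
    sup       : (P : Carrier → Set) → Σ Carrier P →
                Σ Carrier (λ b → ∀ x → P x → (x < b ⊎ x ≈ b)) →
                Σ Carrier (λ s → (∀ x → P x → (x < s ⊎ x ≈ s)) ×
                                 (∀ b → (∀ x → P x → (x < b ⊎ x ≈ b)) → (s < b ⊎ s ≈ b)))

module _ (R : RealField) where
  open RealField R using (Carrier; _≈_; _+_; _*_; -_; 0#; 1#)

  -- A function {-1,1}^n → ℝ, identified with its multilinear expansion,
  -- is given by its Fourier coefficients  f̂ : Subset n → ℝ
  -- (a subset S ⊆ [n] is a Bool-vector; inside = member).
  Coeffs : ℕ → Set
  Coeffs n = Subset n → Carrier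

  eval : ∀ {n} → Coeffs n → (Fin n → Carrier) → Carrier
  eval {zero}  c x = c []
  eval {suc n} c x =
    eval (λ s → c (outside ∷ s)) (λ i → x (suc i))
    + (x zero * eval (λ s → c (inside ∷ s)) (λ i → x (suc i)))

  sgn : Bool → Carrier
  sgn true  = 1#
  sgn false = - 1#

  Balanced : ∀ {n} → Coeffs n → Set
  Balanced c = c ⊥ ≈ 0#

  NonConstant : ∀ {n} → Coeffs n → Set
  NonConstant {n} c = Σ (Fin n → Bool) λ x → Σ (Fin n → Bool) λ y →
    ¬ (eval c (λ i → sgn (x i)) ≈ eval c (λ i → sgn (y i)))

  InSupp : ∀ {n} → Coeffs n → Subset n → Set
  InSupp c S = ¬ (c S ≈ 0#)

  MaximalInSupp : ∀ {n} → Coeffs n → Subset n → Set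
  MaximalInSupp c S = InSupp c S × (∀ S′ → InSupp c S′ → S ⊆ S′ → S ≡ S′)

⋃ᵢ : ∀ {n m} → (Fin n → Subset m) → Subset m
⋃ᵢ {zero}  U = ⊥
⋃ᵢ {suc n} U = U zero ∪ ⋃ᵢ (λ i → U (suc i))

unionOver : ∀ {n m} → Subset n → (Fin n → Subset m) → Subset m
unionOver S U = ⋃ᵢ (λ i → if lookup S i then U i else ⊥)

preimageIn : ∀ {n m} → Subset n → (Fin n → Subset m) → Fin m → Subset n
preimageIn S U j = S ∩ tabulate (λ i → lookup (U i) j)

-- Expand both sides of the identity in the Fourier basis of {−1,1}^([n]×[m]), indexing characters
-- by relations W ⊆ [n] × [m].  Since the gᵢ are balanced, the coefficient of the left-hand side at W
-- is f̂₀(rows W) · Πᵢ ĝᵢ(Wᵢ), where rows W is the set of nonempty rows and the product runs over them;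
-- symmetrically the right-hand side gives ĝ₀(rows Wᵀ) · Πⱼ f̂ⱼ((Wᵀ)ⱼ).  Over a field, W therefore has
-- all factors of the first product nonzero iff Wᵀ has all factors of the second nonzero.  The
-- relation with rows Uᵢ (i ∈ S) is maximal among the former because S and the Uᵢ are maximal;
-- so its transpose, whose nonempty rows form T and whose rows are the Vⱼ, is maximal among the
-- latter.  Maximality of a relation passes to each of its rows, and to its set of nonempty rows
-- by giving each new row a nonempty support set of the (non-constant) fⱼ.

module Submission where

open import Defs
open import Data.Bool using (Bool; true; false; _∧_; if_then_else_)
open import Data.Nat using (ℕ; zero; suc)
open import Data.Fin using (Fin; zero; suc; _≟_)
open import Data.Fin.Subset using (Subset; inside; outside; _∈_; _∉_; _⊆_; ⊥; Nonempty)
open import Data.Fin.Subset.Properties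
  using (nonempty?; anySubset?; _∈?_; Empty-unique; ⊆-antisym; ∉⊥; x∈p∪q⁺; x∈p∪q⁻)
open import Data.Product using (∃; _×_; _,_; proj₁; proj₂; map₂)
open import Data.Sum using (inj₁; inj₂)
open import Data.Vec
  using (Vec; []; _∷_; here; there; lookup; tabulate; map; zipWith; transpose; replicate; _[_]≔_)
open import Data.Vec.Properties
  using ( lookup-zipWith; map-[]≔; []≔-lookup; lookup∘tabulate; tabulate∘lookup; tabulate-cong
        ; lookup-replicate; zipWith-is-⊛; lookup∘update; lookup∘update′; []=⇒lookup; lookup⇒[]=)
open import Tactic.RingSolver.Core.AlmostCommutativeRing using (fromCommutativeRing)
import Tactic.RingSolver.NonReflective as NR
open import Function using (_∘_; _⇔_; Equivalence; mk⇔)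
import Function.Properties.Equivalence as ⇔
open import Relation.Nullary using (¬_; Dec; yes; no; does; contradiction)
open import Relation.Nullary.Decidable using (dec-true; decidable-stable; _×-dec_; ¬?)
open import Data.Maybe using (nothing)
open import Relation.Binary.PropositionalEquality
  using (_≡_; refl; sym; trans; cong; subst; module ≡-Reasoning)

private
  variable
    A : Set
    k m n : ℕ

lookup-injective : {xs ys : Vec A n} → (∀ i → lookup xs i ≡ lookup ys i) → xs ≡ ys
lookup-injective {xs = xs} {ys} eq = begin
  xs                 ≡⟨ sym (tabulate∘lookup xs) ⟩
  tabulate (lookup xs) ≡⟨ tabulate-cong eq ⟩
  tabulate (lookup ys) ≡⟨ tabulate∘lookup ys ⟩
  ys                 ∎
  where open ≡-Reasoning

transpose-∷ : (xs : Vec A n) (xss : Vec (Vec A n) m) →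
              transpose (xs ∷ xss) ≡ zipWith _∷_ xs (transpose xss)
transpose-∷ xs xss = sym (zipWith-is-⊛ _∷_ xs (transpose xss))

lookup-transpose : (xss : Vec (Vec A n) m) (j : Fin n) (i : Fin m) →
                   lookup (lookup (transpose xss) j) i ≡ lookup (lookup xss i) j
lookup-transpose (xs ∷ xss) j i rewrite transpose-∷ xs xss | lookup-zipWith _∷_ j xs (transpose xss)
  with i
... | zero  = refl
... | suc i = lookup-transpose xss j i

transpose-involutive : (xss : Vec (Vec A n) m) → transpose (transpose xss) ≡ xss
transpose-involutive xss = lookup-injective λ i → lookup-injective λ j →
  trans (lookup-transpose (transpose xss) i j) (lookup-transpose xss j i)

transpose-zipWith-∷ : (xs : Vec A m) (xss : Vec (Vec A n) m) →
                      transpose (zipWith _∷_ xs xss) ≡ xs ∷ transpose xss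
transpose-zipWith-∷ xs xss = begin
  transpose (zipWith _∷_ xs xss)
    ≡⟨ cong (transpose ∘ zipWith _∷_ xs) (sym (transpose-involutive xss)) ⟩
  transpose (zipWith _∷_ xs (transpose (transpose xss)))
    ≡⟨ cong transpose (sym (transpose-∷ xs (transpose xss))) ⟩
  transpose (transpose (xs ∷ transpose xss))
    ≡⟨ transpose-involutive (xs ∷ transpose xss) ⟩
  xs ∷ transpose xss
    ∎
  where open ≡-Reasoning

∈-transpose : (W : Vec (Subset n) m) {i : Fin m} {j : Fin n} →
              j ∈ lookup W i → i ∈ lookup (transpose W) j
∈-transpose W {i} {j} j∈Wᵢ =
  lookup⇒[]= i _ (trans (lookup-transpose W j i) ([]=⇒lookup j∈Wᵢ))

∈-transpose⁻ : (W : Vec (Subset n) m) {i : Fin m} {j : Fin n} →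
               i ∈ lookup (transpose W) j → j ∈ lookup W i
∈-transpose⁻ W {i} {j} i∈Wᵀⱼ =
  lookup⇒[]= j _ (trans (sym (lookup-transpose W j i)) ([]=⇒lookup i∈Wᵀⱼ))

Maximal : (A → A → Set) → (A → Set) → A → Set
Maximal _≤_ P x = P x × (∀ y → P y → x ≤ y → x ≡ y)

nonemptyRows : Vec (Subset n) m → Subset m
nonemptyRows = map (λ A → does (nonempty? A))

∈-nonemptyRows⁺ : (W : Vec (Subset n) m) {i : Fin m} → Nonempty (lookup W i) → i ∈ nonemptyRows W
∈-nonemptyRows⁺ (A ∷ W) {zero} ne with nonempty? A
... | yes _  = here
... | no ¬ne = contradiction ne ¬ne
∈-nonemptyRows⁺ (A ∷ W) {suc i} ne = there (∈-nonemptyRows⁺ W ne)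

∈-nonemptyRows⁻ : (W : Vec (Subset n) m) {i : Fin m} → i ∈ nonemptyRows W → Nonempty (lookup W i)
∈-nonemptyRows⁻ (A ∷ W) {zero} i∈ with nonempty? A | i∈
... | yes ne | _ = ne
... | no _   | ()
∈-nonemptyRows⁻ (A ∷ W) {suc i} (there i∈) = ∈-nonemptyRows⁻ W i∈

∉-nonemptyRows : (W : Vec (Subset n) m) {i : Fin m} → i ∉ nonemptyRows W → lookup W i ≡ ⊥
∉-nonemptyRows W i∉ = Empty-unique (i∉ ∘ ∈-nonemptyRows⁺ W)

≢⊥⇒Nonempty : (p : Subset n) → ¬ p ≡ ⊥ → Nonempty p
≢⊥⇒Nonempty p p≢⊥ with nonempty? p
... | yes ne = ne
... | no ¬ne = contradiction (Empty-unique ¬ne) p≢⊥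

∈-⋃ᵢ⁺ : (F : Fin m → Subset n) (i : Fin m) {j : Fin n} → j ∈ F i → j ∈ ⋃ᵢ F
∈-⋃ᵢ⁺ F zero    j∈Fᵢ = x∈p∪q⁺ (inj₁ j∈Fᵢ)
∈-⋃ᵢ⁺ F (suc i) j∈Fᵢ = x∈p∪q⁺ (inj₂ (∈-⋃ᵢ⁺ (F ∘ suc) i j∈Fᵢ))

∈-⋃ᵢ⁻ : (F : Fin m → Subset n) {j : Fin n} → j ∈ ⋃ᵢ F → ∃ λ i → j ∈ F i
∈-⋃ᵢ⁻ {zero}  F j∈⋃ = contradiction j∈⋃ ∉⊥
∈-⋃ᵢ⁻ {suc m} F j∈⋃ with x∈p∪q⁻ (F zero) (⋃ᵢ (F ∘ suc)) j∈⋃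
... | inj₁ j∈F₀ = zero , j∈F₀
... | inj₂ j∈⋃′ with ∈-⋃ᵢ⁻ (F ∘ suc) j∈⋃′
...   | i , j∈Fᵢ = suc i , j∈Fᵢ

nonemptyRows-transpose-tabulate : (F : Fin m → Subset n) → nonemptyRows (transpose (tabulate F)) ≡ ⋃ᵢ F
nonemptyRows-transpose-tabulate F = ⊆-antisym nonemptyRows⊆⋃ ⋃⊆nonemptyRows
  where
  W = tabulate F
  nonemptyRows⊆⋃ : nonemptyRows (transpose W) ⊆ ⋃ᵢ F
  nonemptyRows⊆⋃ {j} j∈ with ∈-nonemptyRows⁻ (transpose W) j∈
  ... | i , i∈Wᵀⱼ = ∈-⋃ᵢ⁺ F i (subst (j ∈_) (lookup∘tabulate F i) (∈-transpose⁻ W i∈Wᵀⱼ))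
  ⋃⊆nonemptyRows : ⋃ᵢ F ⊆ nonemptyRows (transpose W)
  ⋃⊆nonemptyRows {j} j∈ with ∈-⋃ᵢ⁻ F j∈
  ... | i , j∈Fᵢ =
    ∈-nonemptyRows⁺ (transpose W) (i , ∈-transpose W (subst (j ∈_) (sym (lookup∘tabulate F i)) j∈Fᵢ))

-- A matrix W : Vec (Subset n) m stands for the relation {(i, j) : j ∈ W i} ⊆ [m] × [n].
_⊆ᴹ_ : Vec (Subset n) m → Vec (Subset n) m → Set
W ⊆ᴹ W′ = ∀ i → lookup W i ⊆ lookup W′ i

record Admissible (P : Subset m → Set) (Q : Fin m → Subset n → Set) (W : Vec (Subset n) m) : Set where
  constructor admissible
  field
    outer : P (nonemptyRows W)
    inner : ∀ {i} → i ∈ nonemptyRows W → Q i (lookup W i)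

rowsOn : Subset m → (Fin m → Subset n) → Vec (Subset n) m
rowsOn S U = tabulate λ i → if lookup S i then U i else ⊥

lookup-rowsOn-∈ : (S : Subset m) (U : Fin m → Subset n) {i : Fin m} →
                  i ∈ S → lookup (rowsOn S U) i ≡ U i
lookup-rowsOn-∈ S U {i} i∈S
  rewrite lookup∘tabulate (λ k → if lookup S k then U k else ⊥) i | []=⇒lookup i∈S = refl

lookup-rowsOn-∉ : (S : Subset m) (U : Fin m → Subset n) {i : Fin m} →
                  i ∉ S → lookup (rowsOn S U) i ≡ ⊥
lookup-rowsOn-∉ S U {i} i∉S
  rewrite lookup∘tabulate (λ k → if lookup S k then U k else ⊥) i with lookup S i in eq
... | true  = contradiction (lookup⇒[]= i S eq) i∉S
... | false = refl

lookup-transpose-rowsOn : (S : Subset m) (U : Fin m → Subset n) (j : Fin n) →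
                          lookup (transpose (rowsOn S U)) j ≡ preimageIn S U j
lookup-transpose-rowsOn S U j = lookup-injective λ i → begin
  lookup (lookup (transpose W) j) i          ≡⟨ lookup-transpose W j i ⟩
  lookup (lookup W i) j                      ≡⟨ cong (λ A → lookup A j) (lookup∘tabulate _ i) ⟩
  lookup (if lookup S i then U i else ⊥) j   ≡⟨ lookup-if (lookup S i) ⟩
  lookup S i ∧ lookup (U i) j                ≡⟨ cong (lookup S i ∧_) (sym (lookup∘tabulate _ i)) ⟩
  lookup S i ∧ lookup (tabulate λ k → lookup (U k) j) i ≡⟨ sym (lookup-zipWith _∧_ i S _) ⟩
  lookup (preimageIn S U j) i                ∎
  where
  open ≡-Reasoning
  W = rowsOn S U
  lookup-if : ∀ {i} b → lookup (if b then U i else ⊥) j ≡ b ∧ lookup (U i) j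
  lookup-if true  = refl
  lookup-if false = lookup-replicate j false

module _ {P : Subset m → Set} {Q : Fin m → Subset n → Set} where

  maximal-rowsOn : (∀ i → ¬ Q i ⊥) → {S : Subset m} {U : Fin m → Subset n} →
                   Maximal _⊆_ P S → (∀ i → i ∈ S → Maximal _⊆_ (Q i) (U i)) →
                   Maximal _⊆ᴹ_ (Admissible P Q) (rowsOn S U)
  maximal-rowsOn ¬Q⊥ {S} {U} (PS , S-max) U-max = admissible (subst P (sym nonemptyRows≡S) PS) QW , W-max
    where
    W = rowsOn S U

    U-nonempty : ∀ {i} → i ∈ S → Nonempty (U i)
    U-nonempty {i} i∈S = ≢⊥⇒Nonempty (U i) λ Uᵢ≡⊥ → ¬Q⊥ i (subst (Q i) Uᵢ≡⊥ (proj₁ (U-max i i∈S)))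

    S⊆nonemptyRows : ∀ {W′} → W ⊆ᴹ W′ → S ⊆ nonemptyRows W′
    S⊆nonemptyRows {W′} W⊆W′ {i} i∈S with U-nonempty i∈S
    ... | j , j∈Uᵢ = ∈-nonemptyRows⁺ W′ (j , W⊆W′ i (subst (j ∈_) (sym (lookup-rowsOn-∈ S U i∈S)) j∈Uᵢ))

    nonemptyRows⊆S : nonemptyRows W ⊆ S
    nonemptyRows⊆S {i} i∈ with i ∈? S
    ... | yes i∈S = i∈S
    ... | no  i∉S =
      contradiction (subst Nonempty (lookup-rowsOn-∉ S U i∉S) (∈-nonemptyRows⁻ W i∈)) (∉⊥ ∘ proj₂)

    nonemptyRows≡S : nonemptyRows W ≡ S
    nonemptyRows≡S = ⊆-antisym nonemptyRows⊆S (S⊆nonemptyRows λ i x∈ → x∈)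

    QW : ∀ {i} → i ∈ nonemptyRows W → Q i (lookup W i)
    QW {i} i∈ = subst (Q i) (sym (lookup-rowsOn-∈ S U i∈S)) (proj₁ (U-max i i∈S))
      where i∈S = nonemptyRows⊆S i∈

    W-max : ∀ W′ → Admissible P Q W′ → W ⊆ᴹ W′ → W ≡ W′
    W-max W′ (admissible PW′ QW′) W⊆W′ = lookup-injective row
      where
      S≡ : S ≡ nonemptyRows W′
      S≡ = S-max (nonemptyRows W′) PW′ (S⊆nonemptyRows W⊆W′)
      row : ∀ i → lookup W i ≡ lookup W′ i
      row i with i ∈? S
      ... | yes i∈S = trans Wᵢ≡Uᵢ (proj₂ (U-max i i∈S) (lookup W′ i) (QW′ (subst (i ∈_) S≡ i∈S))
                                     (subst (_⊆ lookup W′ i) Wᵢ≡Uᵢ (W⊆W′ i)))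
        where Wᵢ≡Uᵢ = lookup-rowsOn-∈ S U i∈S
      ... | no  i∉S =
        trans (lookup-rowsOn-∉ S U i∉S) (sym (∉-nonemptyRows W′ (i∉S ∘ subst (i ∈_) (sym S≡))))

  maximal-row : ∀ {C} → Maximal _⊆ᴹ_ (Admissible P Q) C →
                ∀ {j} → j ∈ nonemptyRows C → Maximal _⊆_ (Q j) (lookup C j)
  maximal-row {C} (admissible PC QC , C-max) {j} j∈ = QC j∈ , row-max
    where
    row-max : ∀ V → Q j V → lookup C j ⊆ V → lookup C j ≡ V
    row-max V QV Cⱼ⊆V = begin
      lookup C j  ≡⟨ cong (λ D → lookup D j) (C-max C′ admC′ C⊆C′) ⟩
      lookup C′ j ≡⟨ lookup∘update j C V ⟩
      V           ∎
      where
      open ≡-Reasoning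
      C′ = C [ j ]≔ V
      C′-rows≡ : nonemptyRows C′ ≡ nonemptyRows C
      C′-rows≡ = begin
        nonemptyRows C′
          ≡⟨ map-[]≔ _ C j ⟩
        nonemptyRows C [ j ]≔ does (nonempty? V)
          ≡⟨ cong (nonemptyRows C [ j ]≔_) (dec-true (nonempty? V) V-nonempty) ⟩
        nonemptyRows C [ j ]≔ true
          ≡⟨ cong (nonemptyRows C [ j ]≔_) (sym ([]=⇒lookup j∈)) ⟩
        nonemptyRows C [ j ]≔ lookup (nonemptyRows C) j
          ≡⟨ []≔-lookup (nonemptyRows C) j ⟩
        nonemptyRows C
          ∎
        where
        V-nonempty : Nonempty V
        V-nonempty = map₂ Cⱼ⊆V (∈-nonemptyRows⁻ C j∈)
      QC′ : ∀ {k} → k ∈ nonemptyRows C′ → Q k (lookup C′ k)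
      QC′ {k} k∈ with k ≟ j
      ... | yes refl = subst (Q j) (sym (lookup∘update j C V)) QV
      ... | no  k≢j  = subst (Q k) (sym (lookup∘update′ k≢j C V)) (QC (subst (k ∈_) C′-rows≡ k∈))
      C⊆C′ : C ⊆ᴹ C′
      C⊆C′ k with k ≟ j
      ... | yes refl = subst (lookup C j ⊆_) (sym (lookup∘update j C V)) Cⱼ⊆V
      ... | no  k≢j  = subst (lookup C k ⊆_) (sym (lookup∘update′ k≢j C V)) λ x∈ → x∈
      admC′ = admissible (subst P (sym C′-rows≡) PC) QC′

  module RowExtension (witness : ∀ j → ∃ λ V → Nonempty V × Q j V)
           {C : Vec (Subset n) m} (QC : ∀ {j} → j ∈ nonemptyRows C → Q j (lookup C j))
           {T : Subset m} (C⊆T : nonemptyRows C ⊆ T) where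

    extendRows : Fin m → Subset n
    extendRows j with j ∈? T | j ∈? nonemptyRows C
    ... | yes _ | no _ = proj₁ (witness j)
    ... | _     | _    = lookup C j

    extendRows-⊇ : ∀ j → lookup C j ⊆ extendRows j
    extendRows-⊇ j with j ∈? T | j ∈? nonemptyRows C
    ... | yes _ | no j∉ = λ x∈ → contradiction (subst (_ ∈_) (∉-nonemptyRows C j∉) x∈) ∉⊥
    ... | yes _ | yes _ = λ x∈ → x∈
    ... | no _  | _     = λ x∈ → x∈

    extendRows-nonempty⁻ : ∀ j → Nonempty (extendRows j) → j ∈ T
    extendRows-nonempty⁻ j ne with j ∈? T | j ∈? nonemptyRows C
    ... | yes j∈T | _ = j∈T
    ... | no _    | _ = C⊆T (∈-nonemptyRows⁺ C ne)

    extendRows-nonempty⁺ : ∀ {j} → j ∈ T → Nonempty (extendRows j)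
    extendRows-nonempty⁺ {j} j∈T with j ∈? T | j ∈? nonemptyRows C
    ... | yes _  | no _    = proj₁ (proj₂ (witness j))
    ... | yes _  | yes j∈C = ∈-nonemptyRows⁻ C j∈C
    ... | no j∉T | _       = contradiction j∈T j∉T

    extendRows-Q : ∀ j → Nonempty (extendRows j) → Q j (extendRows j)
    extendRows-Q j ne with j ∈? T | j ∈? nonemptyRows C
    ... | yes _ | no _    = proj₂ (proj₂ (witness j))
    ... | yes _ | yes j∈C = QC j∈C
    ... | no _  | _       = QC (∈-nonemptyRows⁺ C ne)

  maximal-nonemptyRows : (∀ j → ∃ λ V → Nonempty V × Q j V) →
                         ∀ {C} → Maximal _⊆ᴹ_ (Admissible P Q) C → Maximal _⊆_ P (nonemptyRows C)
  maximal-nonemptyRows witness {C} (admissible PC QC , C-max) = PC , nonemptyRows-max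
    where
    nonemptyRows-max : ∀ T → P T → nonemptyRows C ⊆ T → nonemptyRows C ≡ T
    nonemptyRows-max T PT C⊆T =
      trans (cong nonemptyRows (C-max C′ (admissible (subst P (sym C′-rows≡T) PT) QC′) C⊆C′)) C′-rows≡T
      where
      open RowExtension witness QC C⊆T
      C′ = tabulate extendRows

      C′≡ : ∀ j → lookup C′ j ≡ extendRows j
      C′≡ = lookup∘tabulate extendRows

      C′-rows≡T : nonemptyRows C′ ≡ T
      C′-rows≡T = ⊆-antisym
        (λ {j} j∈ → extendRows-nonempty⁻ j (subst Nonempty (C′≡ j) (∈-nonemptyRows⁻ C′ j∈)))
        (λ {j} j∈ → ∈-nonemptyRows⁺ C′ (subst Nonempty (sym (C′≡ j)) (extendRows-nonempty⁺ j∈)))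

      QC′ : ∀ {j} → j ∈ nonemptyRows C′ → Q j (lookup C′ j)
      QC′ {j} j∈ = subst (Q j) (sym (C′≡ j))
        (extendRows-Q j (subst Nonempty (C′≡ j) (∈-nonemptyRows⁻ C′ j∈)))

      C⊆C′ : C ⊆ᴹ C′
      C⊆C′ j x∈ = subst (_ ∈_) (sym (C′≡ j)) (extendRows-⊇ j x∈)

maximal-transpose : {P : Subset m → Set} {Q : Fin m → Subset n → Set}
                    {P′ : Subset n → Set} {Q′ : Fin n → Subset m → Set} →
                    (∀ W → Admissible P Q W ⇔ Admissible P′ Q′ (transpose W)) →
                    ∀ {W} → Maximal _⊆ᴹ_ (Admissible P Q) W →
                    Maximal _⊆ᴹ_ (Admissible P′ Q′) (transpose W)
maximal-transpose {P′ = P′} {Q′} adm⇔ {W} (admW , W-max) = Equivalence.to (adm⇔ W) admW , Wᵀ-max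
  where
  Wᵀ-max : ∀ C → Admissible P′ Q′ C → transpose W ⊆ᴹ C → transpose W ≡ C
  Wᵀ-max C admC Wᵀ⊆C = begin
    transpose W             ≡⟨ cong transpose (W-max (transpose C) admCᵀ W⊆Cᵀ) ⟩
    transpose (transpose C) ≡⟨ transpose-involutive C ⟩
    C                       ∎
    where
    open ≡-Reasoning
    admCᵀ = Equivalence.from (adm⇔ (transpose C))
              (subst (Admissible P′ Q′) (sym (transpose-involutive C)) admC)
    W⊆Cᵀ : W ⊆ᴹ transpose C
    W⊆Cᵀ i j∈ = ∈-transpose C (Wᵀ⊆C _ (∈-transpose W j∈))

module _ (R : RealField) where
  open RealField R
    hiding (zero)
    renaming (refl to ≈-refl; sym to ≈-sym; trans to ≈-trans)
  open import Relation.Binary.Reasoning.Setoid setoid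
  open import Algebra.Properties.Ring ring using (-‿distribˡ-*; -‿distribʳ-*; -‿involutive; -1*x≈-x)
  open import Algebra.Properties.CommutativeSemigroup *-commutativeSemigroup using (x∙yz≈y∙xz)
  open NR (fromCommutativeRing commRing (λ _ → nothing)) using (solve; _⊜_; _⊕_; _⊗_)

  _≈?_ : ∀ x y → Dec (x ≈ y)
  x ≈? y with <-tri x y
  ... | inj₁ x<y        = no λ x≈y → <-irrefl (<-resp-≈ x≈y ≈-refl x<y)
  ... | inj₂ (inj₁ x≈y) = yes x≈y
  ... | inj₂ (inj₂ y<x) = no λ x≈y → <-irrefl (<-resp-≈ ≈-refl x≈y y<x)


  0<2 : 0# < (1# + 1#)
  0<2 = <-trans 0<1 (<-resp-≈ (+-identityˡ 1#) ≈-refl (+-mono-< 1# 0<1))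

  1≉0 : 1# ≉ 0#
  1≉0 1≈0 = <-irrefl (<-resp-≈ ≈-refl 1≈0 0<1)

  ½ : Carrier
  ½ = proj₁ (inverse (1# + 1#) λ 2≈0 → <-irrefl (<-resp-≈ ≈-refl 2≈0 0<2))

  ½*x+½*x≈x : ∀ x → ½ * x + ½ * x ≈ x
  ½*x+½*x≈x x = begin
    ½ * x + ½ * x  ≈⟨ distribʳ x ½ ½ ⟨
    (½ + ½) * x    ≈⟨ *-congʳ ½+½≈1 ⟩
    1# * x         ≈⟨ *-identityˡ x ⟩
    x              ∎
    where
    ½+½≈1 : ½ + ½ ≈ 1#
    ½+½≈1 = begin
      ½ + ½            ≈⟨ +-cong (*-identityˡ ½) (*-identityˡ ½) ⟨
      1# * ½ + 1# * ½  ≈⟨ distribʳ ½ 1# 1# ⟨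
      (1# + 1#) * ½    ≈⟨ proj₂ (inverse (1# + 1#) _) ⟩
      1#               ∎

  *-≉0 : ∀ {x y} → x ≉ 0# → y ≉ 0# → x * y ≉ 0#
  *-≉0 {x} {y} x≉0 y≉0 xy≈0 = x≉0 (begin
    x              ≈⟨ *-identityʳ x ⟨
    x * 1#         ≈⟨ *-congˡ y*y⁻¹≈1 ⟨
    x * (y * y⁻¹)  ≈⟨ *-assoc x y y⁻¹ ⟨
    (x * y) * y⁻¹  ≈⟨ *-congʳ xy≈0 ⟩
    0# * y⁻¹       ≈⟨ zeroˡ y⁻¹ ⟩
    0#             ∎)
    where
    y⁻¹ = proj₁ (inverse y y≉0)
    y*y⁻¹≈1 = proj₂ (inverse y y≉0)

  *-≉0ˡ : ∀ {x y} → x * y ≉ 0# → x ≉ 0#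
  *-≉0ˡ {y = y} xy≉0 x≈0 = xy≉0 (≈-trans (*-congʳ x≈0) (zeroˡ y))

  *-≉0ʳ : ∀ {x y} → x * y ≉ 0# → y ≉ 0#
  *-≉0ʳ {x} xy≉0 y≈0 = xy≉0 (≈-trans (*-congˡ y≈0) (zeroʳ x))

  signs : Vec Bool k → Fin k → Carrier
  signs x i = sgn R (lookup x i)

  ½χ : Bool → Carrier
  ½χ true  = - ½
  ½χ false = ½

  -- coeff A G = 𝔼ₓ G(x) Πᵢ∈A xᵢ is the Fourier coefficient at A of G : {−1,1}ᵏ → ℝ (true ↦ 1,
  -- false ↦ −1); the first coordinate is averaged out, ½χ a being half the character at x₀ = −1.
  coeff : Subset k → (Vec Bool k → Carrier) → Carrier
  coeff []      G = G []
  coeff (a ∷ A) G = ½ * coeff A (G ∘ (true ∷_)) + ½χ a * coeff A (G ∘ (false ∷_))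

  coeff-cong : (A : Subset k) {G H : Vec Bool k → Carrier} →
               (∀ x → G x ≈ H x) → coeff A G ≈ coeff A H
  coeff-cong []      G≈H = G≈H []
  coeff-cong (a ∷ A) G≈H = +-cong (*-congˡ (coeff-cong A (G≈H ∘ (true ∷_))))
                                  (*-congˡ (coeff-cong A (G≈H ∘ (false ∷_))))

  coeff-linear : (A : Subset k) (α β : Carrier) (G H : Vec Bool k → Carrier) →
                 coeff A (λ x → α * G x + β * H x) ≈ α * coeff A G + β * coeff A H
  coeff-linear []      α β G H = ≈-refl
  coeff-linear (a ∷ A) α β G H = begin
    ½ * coeff A (λ x → α * G (true ∷ x) + β * H (true ∷ x))
      + ½χ a * coeff A (λ x → α * G (false ∷ x) + β * H (false ∷ x))
      ≈⟨ +-cong (*-congˡ (coeff-linear A α β _ _)) (*-congˡ (coeff-linear A α β _ _)) ⟩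
    ½ * (α * G₁ + β * H₁) + ½χ a * (α * G₀ + β * H₀)
      ≈⟨ solve 8 (λ h c α β g₁ h₁ g₀ h₀ →
                    (h ⊗ (α ⊗ g₁ ⊕ β ⊗ h₁) ⊕ c ⊗ (α ⊗ g₀ ⊕ β ⊗ h₀))
                  ⊜ (α ⊗ (h ⊗ g₁ ⊕ c ⊗ g₀) ⊕ β ⊗ (h ⊗ h₁ ⊕ c ⊗ h₀)))
               ≈-refl ½ (½χ a) α β G₁ H₁ G₀ H₀ ⟩
    α * (½ * G₁ + ½χ a * G₀) + β * (½ * H₁ + ½χ a * H₀) ∎
    where
    G₁ = coeff A (G ∘ (true ∷_))
    G₀ = coeff A (G ∘ (false ∷_))
    H₁ = coeff A (H ∘ (true ∷_))
    H₀ = coeff A (H ∘ (false ∷_))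

  coeff-+* : (A : Subset k) (β : Carrier) (G H : Vec Bool k → Carrier) →
             coeff A (λ x → G x + β * H x) ≈ coeff A G + β * coeff A H
  coeff-+* A β G H = begin
    coeff A (λ x → G x + β * H x)       ≈⟨ coeff-cong A (λ x → +-congʳ (*-identityˡ (G x))) ⟨
    coeff A (λ x → 1# * G x + β * H x)  ≈⟨ coeff-linear A 1# β G H ⟩
    1# * coeff A G + β * coeff A H      ≈⟨ +-congʳ (*-identityˡ _) ⟩
    coeff A G + β * coeff A H           ∎

  coeff-const-⊥ : (c : Carrier) → coeff (⊥ {k}) (λ _ → c) ≈ c
  coeff-const-⊥ {zero}  c = ≈-refl
  coeff-const-⊥ {suc k} c = ≈-trans (½*x+½*x≈x _) (coeff-const-⊥ {k} c)

  coeff-const-nonempty : (A : Subset k) (c : Carrier) → Nonempty A → coeff A (λ _ → c) ≈ 0#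
  coeff-const-nonempty (inside ∷ A) c (zero , here) = begin
    ½ * coeff A (λ _ → c) + - ½ * coeff A (λ _ → c) ≈⟨ distribʳ _ ½ (- ½) ⟨
    (½ + - ½) * coeff A (λ _ → c)                   ≈⟨ *-congʳ (-‿inverseʳ ½) ⟩
    0# * coeff A (λ _ → c)                          ≈⟨ zeroˡ _ ⟩
    0#                                              ∎
  coeff-const-nonempty (a ∷ A) c (suc i , there i∈A) = begin
    ½ * coeff A (λ _ → c) + ½χ a * coeff A (λ _ → c)
      ≈⟨ +-cong (*-congˡ IH) (*-congˡ IH) ⟩
    ½ * 0# + ½χ a * 0#  ≈⟨ +-cong (zeroʳ ½) (zeroʳ (½χ a)) ⟩
    0# + 0#             ≈⟨ +-identityˡ 0# ⟩
    0#                  ∎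
    where IH = coeff-const-nonempty A c (i , i∈A)

  coeff-swap : (A : Subset k) (B : Subset n) (Φ : Vec Bool k → Vec Bool n → Carrier) →
               coeff A (λ x → coeff B (Φ x)) ≈ coeff B (λ y → coeff A (λ x → Φ x y))
  coeff-swap []      B Φ = ≈-refl
  coeff-swap (a ∷ A) B Φ = begin
    ½ * coeff A (λ x → coeff B (Φ (true ∷ x))) + ½χ a * coeff A (λ x → coeff B (Φ (false ∷ x)))
      ≈⟨ +-cong (*-congˡ (coeff-swap A B _)) (*-congˡ (coeff-swap A B _)) ⟩
    ½ * coeff B (λ y → coeff A (λ x → Φ (true ∷ x) y))
      + ½χ a * coeff B (λ y → coeff A (λ x → Φ (false ∷ x) y))
      ≈⟨ coeff-linear B ½ (½χ a) _ _ ⟨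
    coeff B (λ y → ½ * coeff A (λ x → Φ (true ∷ x) y) + ½χ a * coeff A (λ x → Φ (false ∷ x) y)) ∎

  coeff-eval : (A : Subset k) (c : Coeffs R k) → coeff A (λ x → eval R c (signs x)) ≈ c A
  coeff-eval []      c = ≈-refl
  coeff-eval (a ∷ A) c = begin
    ½ * coeff A (λ x → E₀ x + 1# * E₁ x) + ½χ a * coeff A (λ x → E₀ x + - 1# * E₁ x)
      ≈⟨ +-cong (*-congˡ (coeff-+* A 1# E₀ E₁)) (*-congˡ (coeff-+* A (- 1#) E₀ E₁)) ⟩
    ½ * (coeff A E₀ + 1# * coeff A E₁) + ½χ a * (coeff A E₀ + - 1# * coeff A E₁)
      ≈⟨ +-cong (*-congˡ (+-cong (coeff-eval A c₀) (*-congˡ (coeff-eval A c₁))))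
                (*-congˡ (+-cong (coeff-eval A c₀) (*-congˡ (coeff-eval A c₁)))) ⟩
    ½ * (c₀ A + 1# * c₁ A) + ½χ a * (c₀ A + - 1# * c₁ A)
      ≈⟨ +-cong (*-congˡ (+-congˡ (*-identityˡ (c₁ A)))) (*-congˡ (+-congˡ (-1*x≈-x (c₁ A)))) ⟩
    ½ * (c₀ A + c₁ A) + ½χ a * (c₀ A + - c₁ A)
      ≈⟨ average a ⟩
    c (a ∷ A) ∎
    where
    c₀ c₁ : Coeffs R _
    c₀ s = c (outside ∷ s)
    c₁ s = c (inside ∷ s)
    E₀ E₁ : Vec Bool _ → Carrier
    E₀ x = eval R c₀ (signs x)
    E₁ x = eval R c₁ (signs x)
    average : ∀ a → ½ * (c₀ A + c₁ A) + ½χ a * (c₀ A + - c₁ A) ≈ c (a ∷ A)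
    average false = begin
      ½ * (x + y) + ½ * (x + - y)
        ≈⟨ solve 4 (λ h x y y′ → (h ⊗ (x ⊕ y) ⊕ h ⊗ (x ⊕ y′)) ⊜ ((h ⊗ x ⊕ h ⊗ x) ⊕ h ⊗ (y ⊕ y′)))
                 ≈-refl ½ x y (- y) ⟩
      (½ * x + ½ * x) + ½ * (y + - y)  ≈⟨ +-cong (½*x+½*x≈x x) (*-congˡ (-‿inverseʳ y)) ⟩
      x + ½ * 0#                       ≈⟨ +-congˡ (zeroʳ ½) ⟩
      x + 0#                           ≈⟨ +-identityʳ x ⟩
      x                                ∎
      where
      x = c₀ A
      y = c₁ A
    average true = begin
      ½ * (x + y) + - ½ * (x + - y)
        ≈⟨ solve 5 (λ h h′ x y y′ → (h ⊗ (x ⊕ y) ⊕ h′ ⊗ (x ⊕ y′)) ⊜ ((h ⊕ h′) ⊗ x ⊕ (h ⊗ y ⊕ h′ ⊗ y′)))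
                 ≈-refl ½ (- ½) x y (- y) ⟩
      (½ + - ½) * x + (½ * y + - ½ * - y) ≈⟨ +-cong (*-congʳ (-‿inverseʳ ½)) (+-congˡ -½*-y≈½*y) ⟩
      0# * x + (½ * y + ½ * y)            ≈⟨ +-cong (zeroˡ x) (½*x+½*x≈x y) ⟩
      0# + y                              ≈⟨ +-identityˡ y ⟩
      y                                   ∎
      where
      x = c₀ A
      y = c₁ A
      -½*-y≈½*y : - ½ * - y ≈ ½ * y
      -½*-y≈½*y = begin
        - ½ * - y      ≈⟨ -‿distribˡ-* ½ (- y) ⟨
        - (½ * - y)    ≈⟨ -‿cong (-‿distribʳ-* ½ y) ⟨
        - - (½ * y)    ≈⟨ -‿involutive (½ * y) ⟩
        ½ * y          ∎

  coeffᴹ : Vec (Subset k) m → (Vec (Vec Bool k) m → Carrier) → Carrier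
  coeffᴹ []      F = F []
  coeffᴹ (A ∷ W) F = coeff A (λ r → coeffᴹ W (F ∘ (r ∷_)))

  coeffᴹ-cong : (W : Vec (Subset k) m) {F G : Vec (Vec Bool k) m → Carrier} →
                (∀ M → F M ≈ G M) → coeffᴹ W F ≈ coeffᴹ W G
  coeffᴹ-cong []      F≈G = F≈G []
  coeffᴹ-cong (A ∷ W) F≈G = coeff-cong A λ r → coeffᴹ-cong W (F≈G ∘ (r ∷_))

  coeffᴹ-+* : (W : Vec (Subset k) m) (β : Carrier) (F G : Vec (Vec Bool k) m → Carrier) →
              coeffᴹ W (λ M → F M + β * G M) ≈ coeffᴹ W F + β * coeffᴹ W G
  coeffᴹ-+* []      β F G = ≈-refl
  coeffᴹ-+* (A ∷ W) β F G = ≈-trans (coeff-cong A λ r → coeffᴹ-+* W β _ _) (coeff-+* A β _ _)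

  coeffᴹ-replicate-[] : (F : Vec (Vec Bool 0) m → Carrier) →
                        coeffᴹ (replicate m []) F ≈ F (replicate m [])
  coeffᴹ-replicate-[] {zero}  F = ≈-refl
  coeffᴹ-replicate-[] {suc m} F = coeffᴹ-replicate-[] (F ∘ ([] ∷_))

  coeffᴹ-zipWith-∷ : (A : Subset m) (W : Vec (Subset k) m) (F : Vec (Vec Bool (suc k)) m → Carrier) →
                     coeffᴹ (zipWith _∷_ A W) F ≈ coeff A (λ r → coeffᴹ W (F ∘ zipWith _∷_ r))
  coeffᴹ-zipWith-∷ []      []      F = ≈-refl
  coeffᴹ-zipWith-∷ (a ∷ A) (V ∷ W) F = +-cong (*-congˡ (fix true)) (*-congˡ (fix false))
    where
    fix : ∀ b → coeff V (λ x → coeffᴹ (zipWith _∷_ A W) (F ∘ ((b ∷ x) ∷_)))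
              ≈ coeff A (λ r → coeff V (λ x → coeffᴹ W (F ∘ ((b ∷ x) ∷_) ∘ zipWith _∷_ r)))
    fix b = ≈-trans (coeff-cong V λ x → coeffᴹ-zipWith-∷ A W _) (coeff-swap V A _)

  coeffᴹ-transpose : (W : Vec (Subset k) m) (F : Vec (Vec Bool k) m → Carrier) →
                     coeffᴹ W F ≈ coeffᴹ (transpose W) (F ∘ transpose)
  coeffᴹ-transpose {k} [] F = ≈-sym (≈-trans (coeffᴹ-replicate-[] (F ∘ transpose)) (F-[] _))
    where
    F-[] : (M : Vec (Vec Bool k) 0) → F M ≈ F []
    F-[] [] = ≈-refl
  coeffᴹ-transpose (A ∷ W) F = begin
    coeff A (λ r → coeffᴹ W (F ∘ (r ∷_)))
      ≈⟨ coeff-cong A (λ r → coeffᴹ-transpose W _) ⟩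
    coeff A (λ r → coeffᴹ (transpose W) (λ M → F (r ∷ transpose M)))
      ≈⟨ coeff-cong A (λ r → coeffᴹ-cong (transpose W) λ M →
           reflexive (cong F (sym (transpose-zipWith-∷ r M)))) ⟩
    coeff A (λ r → coeffᴹ (transpose W) (F ∘ transpose ∘ zipWith _∷_ r))
      ≈⟨ coeffᴹ-zipWith-∷ A (transpose W) _ ⟨
    coeffᴹ (zipWith _∷_ A (transpose W)) (F ∘ transpose)
      ≡⟨ cong (λ W′ → coeffᴹ W′ (F ∘ transpose)) (sym (transpose-∷ A W)) ⟩
    coeffᴹ (transpose (A ∷ W)) (F ∘ transpose) ∎

  rowFactor : Coeffs R k → Subset k → Carrier
  rowFactor c A = if does (nonempty? A) then c A else 1#

  ∏-rows : (Fin m → Coeffs R k) → Vec (Subset k) m → Carrier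
  ∏-rows h []      = 1#
  ∏-rows h (A ∷ W) = rowFactor (h zero) A * ∏-rows (h ∘ suc) W

  weight : Coeffs R m → (Fin m → Coeffs R k) → Vec (Subset k) m → Carrier
  weight p h W = p (nonemptyRows W) * ∏-rows h W

  coeff-affine : (A : Subset k) (c : Coeffs R k) → Balanced R c → (X Y : Carrier) →
                 coeff A (λ x → X + eval R c (signs x) * Y) ≈ (if does (nonempty? A) then c A * Y else X)
  coeff-affine {k} A c balanced X Y = begin
    coeff A (λ x → X + eval R c (signs x) * Y)
      ≈⟨ coeff-cong A (λ x → +-cong (*-identityʳ X) (*-comm Y _)) ⟨
    coeff A (λ x → X * 1# + Y * eval R c (signs x))
      ≈⟨ coeff-linear A X Y _ _ ⟩
    X * coeff A (λ _ → 1#) + Y * coeff A (λ x → eval R c (signs x))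
      ≈⟨ +-congˡ (*-congˡ (coeff-eval A c)) ⟩
    X * coeff A (λ _ → 1#) + Y * c A
      ≈⟨ by-emptiness (nonempty? A) ⟩
    (if does (nonempty? A) then c A * Y else X) ∎
    where
    by-emptiness : (d : Dec (Nonempty A)) →
                   X * coeff A (λ _ → 1#) + Y * c A ≈ (if does d then c A * Y else X)
    by-emptiness (yes A≢∅) = begin
      X * coeff A (λ _ → 1#) + Y * c A  ≈⟨ +-congʳ (*-congˡ (coeff-const-nonempty A 1# A≢∅)) ⟩
      X * 0# + Y * c A                  ≈⟨ +-congʳ (zeroʳ X) ⟩
      0# + Y * c A                      ≈⟨ +-identityˡ _ ⟩
      Y * c A                           ≈⟨ *-comm Y (c A) ⟩
      c A * Y                           ∎
    by-emptiness (no A≡∅) rewrite Empty-unique A≡∅ = begin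
      X * coeff (⊥ {k}) (λ _ → 1#) + Y * c ⊥
        ≈⟨ +-cong (*-congˡ (coeff-const-⊥ {k} 1#)) (*-congˡ balanced) ⟩
      X * 1# + Y * 0#                         ≈⟨ +-cong (*-identityʳ X) (zeroʳ Y) ⟩
      X + 0#                                  ≈⟨ +-identityʳ X ⟩
      X                                       ∎

  coeffᴹ-compose : (p : Coeffs R m) (h : Fin m → Coeffs R k) → (∀ i → Balanced R (h i)) →
                   (W : Vec (Subset k) m) →
                   coeffᴹ W (λ M → eval R p (λ i → eval R (h i) (signs (lookup M i)))) ≈ weight p h W
  coeffᴹ-compose p h balanced []      = ≈-sym (*-identityʳ (p []))
  coeffᴹ-compose p h balanced (A ∷ W) = begin
    coeff A (λ r → coeffᴹ W (λ M → P₀ M + eval R (h zero) (signs r) * P₁ M))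
      ≈⟨ coeff-cong A (λ r → ≈-trans (coeffᴹ-+* W _ P₀ P₁) (+-cong IH₀ (*-congˡ IH₁))) ⟩
    coeff A (λ r → X + eval R (h zero) (signs r) * Y)
      ≈⟨ coeff-affine A (h zero) (balanced zero) X Y ⟩
    (if does (nonempty? A) then h zero A * Y else X)
      ≈⟨ regroup (nonempty? A) ⟩
    weight p h (A ∷ W) ∎
    where
    p₀ p₁ : Coeffs R _
    p₀ s = p (outside ∷ s)
    p₁ s = p (inside ∷ s)
    P₀ P₁ : Vec (Vec Bool _) _ → Carrier
    P₀ M = eval R p₀ (λ i → eval R (h (suc i)) (signs (lookup M i)))
    P₁ M = eval R p₁ (λ i → eval R (h (suc i)) (signs (lookup M i)))
    X = weight p₀ (h ∘ suc) W
    Y = weight p₁ (h ∘ suc) W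
    IH₀ = coeffᴹ-compose p₀ (h ∘ suc) (balanced ∘ suc) W
    IH₁ = coeffᴹ-compose p₁ (h ∘ suc) (balanced ∘ suc) W
    regroup : (d : Dec (Nonempty A)) →
              (if does d then h zero A * Y else X)
                ≈ p (does d ∷ nonemptyRows W) * ((if does d then h zero A else 1#) * ∏-rows (h ∘ suc) W)
    regroup (yes _) = x∙yz≈y∙xz (h zero A) (p₁ (nonemptyRows W)) (∏-rows (h ∘ suc) W)
    regroup (no _)  = *-congˡ (≈-sym (*-identityˡ _))

  ∏-rows-≉0 : (h : Fin m → Coeffs R k) (W : Vec (Subset k) m) →
              (∀ {i} → i ∈ nonemptyRows W → h i (lookup W i) ≉ 0#) → ∏-rows h W ≉ 0#
  ∏-rows-≉0 h []      _    = 1≉0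
  ∏-rows-≉0 h (A ∷ W) h≉0 with nonempty? A
  ... | yes _ = *-≉0 (h≉0 here) (∏-rows-≉0 (h ∘ suc) W λ i∈ → h≉0 (there i∈))
  ... | no  _ = *-≉0 1≉0        (∏-rows-≉0 (h ∘ suc) W λ i∈ → h≉0 (there i∈))

  ∏-rows-≉0⁻ : (h : Fin m → Coeffs R k) (W : Vec (Subset k) m) →
               ∏-rows h W ≉ 0# → ∀ {i} → i ∈ nonemptyRows W → h i (lookup W i) ≉ 0#
  ∏-rows-≉0⁻ h (A ∷ W) ∏≉0 {zero} i∈ with nonempty? A | i∈
  ... | yes _ | _  = *-≉0ˡ ∏≉0
  ... | no  _ | ()
  ∏-rows-≉0⁻ h (A ∷ W) ∏≉0 {suc i} (there i∈) = ∏-rows-≉0⁻ (h ∘ suc) W (*-≉0ʳ ∏≉0) i∈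

  weight-≉0⇔admissible : (p : Coeffs R m) (h : Fin m → Coeffs R k) (W : Vec (Subset k) m) →
                         weight p h W ≉ 0# ⇔ Admissible (InSupp R p) (InSupp R ∘ h) W
  weight-≉0⇔admissible p h W = mk⇔ to from
    where
    to : weight p h W ≉ 0# → Admissible (InSupp R p) (InSupp R ∘ h) W
    to w≉0 = admissible (*-≉0ˡ w≉0) (∏-rows-≉0⁻ h W (*-≉0ʳ w≉0))
    from : Admissible (InSupp R p) (InSupp R ∘ h) W → weight p h W ≉ 0#
    from (admissible p≉0 h≉0) = *-≉0 p≉0 (∏-rows-≉0 h W h≉0)

  eval-cong : (c : Coeffs R k) {x y : Fin k → Carrier} → (∀ i → x i ≈ y i) → eval R c x ≈ eval R c y
  eval-cong {zero}  c x≈y = ≈-refl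
  eval-cong {suc k} c x≈y =
    +-cong (eval-cong _ (x≈y ∘ suc)) (*-cong (x≈y zero) (eval-cong _ (x≈y ∘ suc)))

  weight-transpose :
    (f₀ : Coeffs R n) (g : Fin n → Coeffs R m) (g₀ : Coeffs R m) (f : Fin m → Coeffs R n) →
    (∀ (z : Fin n → Fin m → Bool) →
      eval R f₀ (λ i → eval R (g i) (λ j → sgn R (z i j)))
        ≈ eval R g₀ (λ j → eval R (f j) (λ i → sgn R (z i j)))) →
    (∀ i → Balanced R (g i)) → (∀ j → Balanced R (f j)) →
    (W : Vec (Subset m) n) → weight f₀ g W ≈ weight g₀ f (transpose W)
  weight-transpose f₀ g g₀ f commute g-balanced f-balanced W = begin
    weight f₀ g W
      ≈⟨ coeffᴹ-compose f₀ g g-balanced W ⟨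
    coeffᴹ W (λ M → eval R f₀ (λ i → eval R (g i) (signs (lookup M i))))
      ≈⟨ coeffᴹ-cong W (λ M → commute λ i j → lookup (lookup M i) j) ⟩
    coeffᴹ W (λ M → eval R g₀ (λ j → eval R (f j) (λ i → sgn R (lookup (lookup M i) j))))
      ≈⟨ coeffᴹ-transpose W _ ⟩
    coeffᴹ (transpose W)
      (λ M → eval R g₀ (λ j → eval R (f j) (λ i → sgn R (lookup (lookup (transpose M) i) j))))
      ≈⟨ coeffᴹ-cong (transpose W) (λ M → eval-cong g₀ λ j → eval-cong (f j) λ i →
           reflexive (cong (sgn R) (lookup-transpose M i j))) ⟩
    coeffᴹ (transpose W) (λ M → eval R g₀ (λ j → eval R (f j) (signs (lookup M j))))
      ≈⟨ coeffᴹ-compose g₀ f f-balanced (transpose W) ⟩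
    weight g₀ f (transpose W) ∎

  admissible-transpose :
    (f₀ : Coeffs R n) (g : Fin n → Coeffs R m) (g₀ : Coeffs R m) (f : Fin m → Coeffs R n) →
    (∀ W → weight f₀ g W ≈ weight g₀ f (transpose W)) →
    ∀ W → Admissible (InSupp R f₀) (InSupp R ∘ g) W
            ⇔ Admissible (InSupp R g₀) (InSupp R ∘ f) (transpose W)
  admissible-transpose f₀ g g₀ f w≈wᵀ W =
    ⇔.trans (⇔.sym (weight-≉0⇔admissible f₀ g W))
      (⇔.trans (mk⇔ (λ w≉0 wᵀ≈0 → w≉0 (≈-trans (w≈wᵀ W) wᵀ≈0))
                    (λ wᵀ≉0 w≈0 → wᵀ≉0 (≈-trans (≈-sym (w≈wᵀ W)) w≈0)))
               (weight-≉0⇔admissible g₀ f (transpose W)))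

  eval-constant : (c : Coeffs R k) → (∀ V → Nonempty V → c V ≈ 0#) → ∀ x → eval R c x ≈ c ⊥
  eval-constant {zero}  c _   x = ≈-refl
  eval-constant {suc k} c c≈0 x = begin
    eval R c₀ (x ∘ suc) + x zero * eval R c₁ (x ∘ suc)
      ≈⟨ +-cong (eval-constant c₀ (λ V (i , i∈V) → c≈0 (outside ∷ V) (suc i , there i∈V)) _)
                (*-congˡ (eval-constant c₁ (λ V (i , i∈V) → c≈0 (inside ∷ V) (suc i , there i∈V)) _)) ⟩
    c₀ ⊥ + x zero * c₁ ⊥   ≈⟨ +-congˡ (*-congˡ (c≈0 (inside ∷ ⊥) (zero , here))) ⟩
    c₀ ⊥ + x zero * 0#     ≈⟨ +-congˡ (zeroʳ (x zero)) ⟩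
    c₀ ⊥ + 0#              ≈⟨ +-identityʳ (c₀ ⊥) ⟩
    c ⊥                    ∎
    where
    c₀ c₁ : Coeffs R k
    c₀ s = c (outside ∷ s)
    c₁ s = c (inside ∷ s)

  nonempty-support : (c : Coeffs R k) → NonConstant R c → ∃ λ V → Nonempty V × InSupp R c V
  nonempty-support c (x , y , cx≉cy)
    with anySubset? (λ V → nonempty? V ×-dec ¬? (c V ≈? 0#))
  ... | yes found = found
  ... | no  none  = contradiction (≈-trans (eval-constant c c≈0 _) (≈-sym (eval-constant c c≈0 _))) cx≉cy
    where
    c≈0 : ∀ V → Nonempty V → c V ≈ 0#
    c≈0 V V≢∅ = decidable-stable (c V ≈? 0#) λ c≉0 → none (V , V≢∅ , c≉0)

lemma2p15 : (R : RealField) → let open RealField R using (_≈_) in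
    (n m : ℕ) →
    (f : Fin (suc m) → Coeffs R n) → (g : Fin (suc n) → Coeffs R m) →
    (∀ (z : Fin n → Fin m → Bool) →
      eval R (f zero) (λ i → eval R (g (suc i)) (λ j → sgn R (z i j)))
        ≈ eval R (g zero) (λ j → eval R (f (suc j)) (λ i → sgn R (z i j)))) →
    (∀ j → Balanced R (f (suc j))) → (∀ j → NonConstant R (f (suc j))) →
    (∀ i → Balanced R (g (suc i))) → (∀ i → NonConstant R (g (suc i))) →
    (S : Subset n) → MaximalInSupp R (f zero) S →
    (U : Fin n → Subset m) → (∀ i → i ∈ S → MaximalInSupp R (g (suc i)) (U i)) →
    MaximalInSupp R (g zero) (unionOver S U)
      × (∀ j → j ∈ unionOver S U → MaximalInSupp R (f (suc j)) (preimageIn S U j))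
lemma2p15 R n m f g commute f-balanced f-nonconstant g-balanced _ S S-max U U-max =
  subst (Maximal _⊆_ (InSupp R g₀)) rows≡T (maximal-nonemptyRows f-support C-max) ,
  λ j j∈T → subst (Maximal _⊆_ (InSupp R (f′ j))) (lookup-transpose-rowsOn S U j)
                  (maximal-row C-max (subst (j ∈_) (sym rows≡T) j∈T))
  where
  f₀ = f zero
  g₀ = g zero
  f′ = f ∘ suc
  g′ = g ∘ suc

  W-max : Maximal _⊆ᴹ_ (Admissible (InSupp R f₀) (InSupp R ∘ g′)) (rowsOn S U)
  W-max = maximal-rowsOn (λ i gᵢ⊥≉0 → gᵢ⊥≉0 (g-balanced i)) S-max U-max

  C-max : Maximal _⊆ᴹ_ (Admissible (InSupp R g₀) (InSupp R ∘ f′)) (transpose (rowsOn S U))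
  C-max = maximal-transpose
    (admissible-transpose R f₀ g′ g₀ f′ (weight-transpose R f₀ g′ g₀ f′ commute g-balanced f-balanced))
    W-max

  rows≡T : nonemptyRows (transpose (rowsOn S U)) ≡ unionOver S U
  rows≡T = nonemptyRows-transpose-tabulate _

  f-support : ∀ j → ∃ λ V → Nonempty V × InSupp R (f′ j) V
  f-support j = nonempty-support R (f′ j) (f-nonconstant j)
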